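{- For all $n\ge1$ and $k\ge2$, $\displaystyle R_{kn}=R_nR_{(k-1)n}+\sum_{i=1}^{n}\sum_{j=1}^{(k-1)n}R_{n-i}R_{(k-1)n-j}\widetilde R_{i+j}$.
   Context: Let $q\ge 4$ be an integer and consider the regular square mosaic $\{4,q\}$ (Schläfli symbol), i.e. the tiling of the Euclidean plane ($q=4$) or of the hyperbolic plane ($q\ge5$) by congruent regular squares with $q$ squares around each vertex. For $n\ge1$ the $(2\times n)$-board is defined as follows. Choose a square $S_1$ of the mosaic with vertices $A_0,A_1,B_1,B_0$ in cyclic order. Inductively, for $i\ge1$ let $S_{i+1}$ be the other square of the mosaic containing the edge $A_iB_i$, with vertices $A_i,A_{i+1},B_{i+1},B_i$ in cyclic order. The first level of the board consists of $S_1,\dots,S_n$; the second level consists of all squares of the mosaic having at least one vertex in $\{A_1,\dots,A_n\}$ and no vertex in $\{B_1,\dots,B_n,A_{n+1}\}$ (here $A_{n+1}$ is the vertex of $S_{n+1}$). The board is the union of both levels. For $1\le j\le n$ the $j$-th column consists of $S_j$ together with the second-level squares that contain $A_j$ but not $A_{j+1}$. A domino is a pair of squares of the board sharing an edge. Given positive integers $a,b$, a colored tiling is a partition of the squares of the board into single squares and dominoes, each single square receiving one of $a$ colors and each domino one of $b$ colors. A tiling is breakable in position $i$ ($1\le i\le n-1$) if no domino contains a square of the first $i$ columns and a square of the remaining columns; it is unbreakable if it is breakable in no position. $R_n$ is the number of colored tilings of the $(2\times n)$-board ($R_0=1$) and $\widetilde R_n$ the number of unbreakable colored tilings of it. -}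

module Defs where

open import Data.Nat using (ℕ; zero; suc; _+_; _*_; _∸_; _<ᵇ_; _≡ᵇ_)
open import Data.Bool using (Bool; true; false; _∧_; _∨_; not)
open import Data.Fin using (Fin; toℕ)
open import Data.Fin.Base using () renaming (zero to fz; suc to fs)
open import Data.Product using (_×_; _,_; proj₁)
open import Data.Sum using (_⊎_; inj₁; inj₂)
open import Data.List using (List; []; _∷_; map; concatMap; length; filterᵇ; allFin; cartesianProduct; upTo)

-- Combinatorial model of the (2×n)-board of the square mosaic {4,q}.
--
-- Column j (0-indexed, j < n) consists of q-2 squares, indexed by
-- p : Fin (q ∸ 2):  p = 0 is the first-level square S_{j+1}; p = 1,…,q-3
-- are the second-level squares around A_{j+1} (containing A_{j+1} but not
-- A_{j+2}), listed in the order in which they surround A_{j+1}, starting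
-- from the one sharing the edge A_j A_{j+1} with S_{j+1}.
-- Edge-adjacencies (shared edges) of the board:
--   * inside a column: p and p+1 (consecutive squares around A_{j+1},
--     and S_{j+1} with the square across its edge A_j A_{j+1});
--   * between columns j and j+1: S_{j+1}–S_{j+2} (edge A_{j+1}B_{j+1}),
--     and the last second-level square of column j (p = q-3) with the first
--     second-level square of column j+1 (p = 1) (they share an edge
--     issuing from A_{j+1}).

allB : ∀ {A : Set} → (A → Bool) → List A → Bool
allB p [] = true
allB p (x ∷ xs) = p x ∧ allB p xs

anyB : ∀ {A : Set} → (A → Bool) → List A → Bool
anyB p [] = false
anyB p (x ∷ xs) = p x ∨ anyB p xs

Cell : ℕ → ℕ → Set
Cell q n = Fin n × Fin (q ∸ 2)

column : ∀ q {n} → Cell q n → ℕ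
column q (j , _) = toℕ j

_=ᶠ_ : ∀ {m} → Fin m → Fin m → Bool
x =ᶠ y = toℕ x ≡ᵇ toℕ y

horiz : (q : ℕ) → ℕ → ℕ → ℕ → ℕ → Bool
horiz q j p j' p' =
  (j' ≡ᵇ suc j) ∧ (((p ≡ᵇ 0) ∧ (p' ≡ᵇ 0)) ∨ ((p ≡ᵇ (q ∸ 3)) ∧ (p' ≡ᵇ 1)))

adjacent : ∀ q {n} → Cell q n → Cell q n → Bool
adjacent q (j , p) (j' , p') =
  ((toℕ j ≡ᵇ toℕ j') ∧ ((toℕ p' ≡ᵇ suc (toℕ p)) ∨ (toℕ p ≡ᵇ suc (toℕ p'))))
  ∨ horiz q (toℕ j) (toℕ p) (toℕ j') (toℕ p')
  ∨ horiz q (toℕ j') (toℕ p') (toℕ j) (toℕ p)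

-- A colored tiling is encoded (bijectively) by the map
-- sending each cell x to
--   inj₁ c        if x is a single square of color c : Fin a, or
--   inj₂ (y , c)  if x lies in a domino {x , y} of color c : Fin b.
-- Such a map encodes a tiling iff every domino entry is symmetric
-- (y is then labelled inj₂ (x , c)) and x, y share an edge.

Label : ℕ → ℕ → ℕ → ℕ → Set
Label q n a b = Fin a ⊎ (Cell q n × Fin b)

Assignment : ℕ → ℕ → ℕ → ℕ → Set
Assignment q n a b = Cell q n → Label q n a b

cellEq : ∀ q {n} → Cell q n → Cell q n → Bool
cellEq q (j , p) (j' , p') = (j =ᶠ j') ∧ (p =ᶠ p')

labelIs : ∀ q {n a b} → Label q n a b → Cell q n → Fin b → Bool
labelIs q (inj₁ _) x c = false
labelIs q (inj₂ (y , c')) x c = cellEq q y x ∧ (c' =ᶠ c)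

allCells : (q n : ℕ) → List (Cell q n)
allCells q n = cartesianProduct (allFin n) (allFin (q ∸ 2))

isTiling : ∀ q n a b → Assignment q n a b → Bool
isTiling q n a b f = allB ok (allCells q n)
  where
  ok : Cell q n → Bool
  ok x with f x
  ... | inj₁ _ = true
  ... | inj₂ (y , c) = adjacent q x y ∧ labelIs q (f y) x c

allFuns : ∀ {A : Set} (k : ℕ) → List A → List (Fin k → A)
allFuns zero xs = (λ ()) ∷ []
allFuns (suc k) xs =
  concatMap (λ x → map (λ f → cons x f) (allFuns k xs)) xs
  where
  cons : ∀ {A : Set} {k} → A → (Fin k → A) → Fin (suc k) → A
  cons x f fz = x
  cons x f (fs i) = f i

allLabels : (q n a b : ℕ) → List (Label q n a b)
allLabels q n a b =
  map inj₁ (allFin a) Data.List.++ map inj₂ (cartesianProduct (allCells q n) (allFin b))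

allAssignments : (q n a b : ℕ) → List (Assignment q n a b)
allAssignments q n a b =
  map uncurry′ (allFuns n (allFuns (q ∸ 2) (allLabels q n a b)))
  where
  uncurry′ : (Fin n → Fin (q ∸ 2) → Label q n a b) → Assignment q n a b
  uncurry′ g (j , p) = g j p

-- R_n : number of colored tilings of the (2×n)-board (R_0 = 1 automatically)
R : (q a b n : ℕ) → ℕ
R q a b n = length (filterᵇ (isTiling q n a b) (allAssignments q n a b))

-- Positions i = 1,…,n-1; the first i columns are the
-- columns with 0-indexed number < i.

crosses : ∀ q {n a b} → ℕ → Cell q n → Label q n a b → Bool
crosses q i x (inj₁ _) = false
crosses q i x (inj₂ (y , _)) =
  ((column q x <ᵇ i) ∧ not (column q y <ᵇ i)) ∨ ((column q y <ᵇ i) ∧ not (column q x <ᵇ i))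

breakableAt : ∀ q n a b → Assignment q n a b → ℕ → Bool
breakableAt q n a b f i = not (anyB (λ x → crosses q i x (f x)) (allCells q n))

positions : ℕ → List ℕ
positions n = map suc (upTo (n ∸ 1))

isUnbreakable : ∀ q n a b → Assignment q n a b → Bool
isUnbreakable q n a b f = allB (λ i → not (breakableAt q n a b f i)) (positions n)

Rt : (q a b n : ℕ) → ℕ
Rt q a b n =
  length (filterᵇ (λ f → isTiling q n a b f ∧ isUnbreakable q n a b f)
                  (allAssignments q n a b))

sum1to : ℕ → (ℕ → ℕ) → ℕ
sum1to zero f = 0
sum1to (suc m) f = sum1to m f + f (suc m)

-- Every tiling of the (2×m)-board, m ≥ 1, has a last position s < m at which it breaks
-- (s = 0 when it is unbreakable).  Columns and adjacencies of the board are invariant under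
-- shifting, so cutting there splits it into an arbitrary tiling of the first s columns and an
-- unbreakable tiling of the last m − s; hence R_m = Σ_{s<m} R_s R̃_{m−s}, i.e. R = δ + R ⋆ R̃⁺
-- for the convolution ⋆.  The identity follows from this renewal equation alone, by induction
-- on y in R_{x+y} = R_x R_y + Σ_{i,j ≥ 1} R_{x−i} R_{y−j} R̃_{i+j} using that ⋆ is associative
-- and commutative, and is then read off at x = n, y = (k − 1) n.

module Submission where

import Algebra.Properties.CommutativeSemigroup
open import Data.Bool using (Bool; true; false; _∧_; _∨_; not)
open import Data.Bool.Properties using (∧-conicalˡ; ∧-conicalʳ; ∧-assoc; ∧-identityʳ; ∧-zeroʳ; T-≡)
open import Data.Empty using (⊥)
open import Data.Fin using (Fin; toℕ; _↑ˡ_; _↑ʳ_; splitAt) renaming (zero to fzero; suc to fsuc)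
open import Data.Fin.Properties using (toℕ-↑ˡ; toℕ-↑ʳ; toℕ<n; splitAt⁻¹-↑ˡ; splitAt⁻¹-↑ʳ)
open import Data.List
  using (List; []; _∷_; _++_; map; concatMap; length; filterᵇ; allFin; cartesianProduct; tabulate; applyUpTo)
open import Data.List.Membership.Propositional using (_∈_)
open import Data.List.Membership.Propositional.Properties using (∈-cartesianProduct⁺; ∈-allFin)
open import Data.List.Relation.Unary.Any using (here; there)
open import Data.Nat
open import Data.Nat.Induction using (<-rec)
open import Data.Nat.Properties
open import Data.Product using (_,_; ∃-syntax)
open import Data.Sum using (inj₁; inj₂)
open import Data.Vec.Functional using (Vector) renaming (_∷_ to _∷ᵛ_; _++_ to _++ᵛ_)
open import Data.Vec.Functional.Properties using (lookup-++ˡ; lookup-++ʳ)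
open import Data.Vec.Functional.Relation.Binary.Pointwise using (Pointwise)
open import Data.Vec.Functional.Relation.Unary.Any using (Any)
open import Function using (_∘_; Equivalence)
open import Level using (0ℓ)
open import Relation.Binary.Core using (Rel; _Preserves_⟶_)
open import Relation.Binary.Definitions using (Reflexive)
open import Relation.Binary.PropositionalEquality
open import Relation.Nullary using (contradiction)
open import Defs
open ≡-Reasoning

module +-CS = Algebra.Properties.CommutativeSemigroup +-commutativeSemigroup
module *-CS = Algebra.Properties.CommutativeSemigroup *-commutativeSemigroup

-- Antidiagonal sums and convolution

ifPos : ℕ → ℕ → ℕ
ifPos zero    _ = 0
ifPos (suc _) v = v

_⁺ : (ℕ → ℕ) → ℕ → ℕ
(f ⁺) n = ifPos n (f n)

ifPos-zero : ∀ i → ifPos i 0 ≡ 0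
ifPos-zero zero    = refl
ifPos-zero (suc i) = refl

diagSum : ℕ → (ℕ → ℕ → ℕ) → ℕ
diagSum zero    g = g 0 0
diagSum (suc n) g = g 0 (suc n) + diagSum n (λ u v → g (suc u) v)

infix 5 diagSum
syntax diagSum n (λ u v → e) = ∑[ u + v ≡ n ] e

diagSum-cong : ∀ n {g h : ℕ → ℕ → ℕ} → (∀ u v → u + v ≡ n → g u v ≡ h u v) → diagSum n g ≡ diagSum n h
diagSum-cong zero    e = e 0 0 refl
diagSum-cong (suc n) e = cong₂ _+_ (e 0 (suc n) refl) (diagSum-cong n (λ u v eq → e (suc u) v (cong suc eq)))

diagSum-ext : ∀ n {g h : ℕ → ℕ → ℕ} → (∀ u v → g u v ≡ h u v) → diagSum n g ≡ diagSum n h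
diagSum-ext n e = diagSum-cong n (λ u v _ → e u v)

diagSum-+ : ∀ n (g h : ℕ → ℕ → ℕ) → diagSum n (λ u v → g u v + h u v) ≡ diagSum n g + diagSum n h
diagSum-+ zero    g h = refl
diagSum-+ (suc n) g h =
  trans (cong (g 0 (suc n) + h 0 (suc n) +_) (diagSum-+ n (λ u → g (suc u)) (λ u → h (suc u))))
        (+-CS.interchange (g 0 (suc n)) (h 0 (suc n)) _ _)

diagSum-*ˡ : ∀ n c (g : ℕ → ℕ → ℕ) → diagSum n (λ u v → c * g u v) ≡ c * diagSum n g
diagSum-*ˡ zero    c g = refl
diagSum-*ˡ (suc n) c g = trans (cong (c * g 0 (suc n) +_) (diagSum-*ˡ n c _)) (sym (*-distribˡ-+ c _ _))

diagSum-*ʳ : ∀ n c (g : ℕ → ℕ → ℕ) → diagSum n (λ u v → g u v * c) ≡ diagSum n g * c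
diagSum-*ʳ n c g = trans (diagSum-ext n (λ u v → *-comm (g u v) c)) (trans (diagSum-*ˡ n c g) (*-comm c _))

diagSum-sucʳ : ∀ n (g : ℕ → ℕ → ℕ) → diagSum (suc n) g ≡ diagSum n (λ u v → g u (suc v)) + g (suc n) 0
diagSum-sucʳ zero    g = refl
diagSum-sucʳ (suc n) g =
  trans (cong (g 0 (suc (suc n)) +_) (diagSum-sucʳ n (λ u v → g (suc u) v))) (sym (+-assoc (g 0 (suc (suc n))) _ _))

diagSum-swap : ∀ n (g : ℕ → ℕ → ℕ) → diagSum n g ≡ diagSum n (λ u v → g v u)
diagSum-swap zero    g = refl
diagSum-swap (suc n) g = begin
  g 0 (suc n) + diagSum n (λ u v → g (suc u) v)  ≡⟨ cong (g 0 (suc n) +_) (diagSum-swap n _) ⟩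
  g 0 (suc n) + diagSum n (λ u v → g (suc v) u)  ≡⟨ +-comm (g 0 (suc n)) _ ⟩
  diagSum n (λ u v → g (suc v) u) + g 0 (suc n)  ≡⟨ sym (diagSum-sucʳ n (λ u v → g v u)) ⟩
  diagSum (suc n) (λ u v → g v u)                ∎

diagSum-headˡ : ∀ n (g : ℕ → ℕ → ℕ) → diagSum n g ≡ g 0 n + diagSum n (λ u v → ifPos u (g u v))
diagSum-headˡ zero    g = sym (+-identityʳ _)
diagSum-headˡ (suc n) g = refl

diagSum-fubini : ∀ m n (G : ℕ → ℕ → ℕ → ℕ → ℕ) →
  diagSum m (λ u i → diagSum n (λ v j → G u i v j)) ≡ diagSum n (λ v j → diagSum m (λ u i → G u i v j))
diagSum-fubini zero    n G = refl
diagSum-fubini (suc m) n G =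
  trans (cong (diagSum n (G 0 (suc m)) +_) (diagSum-fubini m n (λ u → G (suc u)))) (sym (diagSum-+ n _ _))

diagSum-assoc : ∀ n (g : ℕ → ℕ → ℕ → ℕ) →
  diagSum n (λ t w → diagSum t (λ u v → g u v w)) ≡ diagSum n (λ u z → diagSum z (λ v w → g u v w))
diagSum-assoc zero    g = refl
diagSum-assoc (suc n) g = begin
  g 0 0 (suc n) + diagSum n (λ t w → g 0 (suc t) w + diagSum t (λ u v → g (suc u) v w))
    ≡⟨ cong (g 0 0 (suc n) +_) (diagSum-+ n _ _) ⟩
  g 0 0 (suc n) + (diagSum n (λ t w → g 0 (suc t) w) + diagSum n (λ t w → diagSum t (λ u v → g (suc u) v w)))
    ≡⟨ cong (λ z → g 0 0 (suc n) + (diagSum n (λ t w → g 0 (suc t) w) + z)) (diagSum-assoc n (λ u → g (suc u))) ⟩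
  g 0 0 (suc n) + (diagSum n (λ t w → g 0 (suc t) w) + diagSum n (λ u z → diagSum z (λ v w → g (suc u) v w)))
    ≡⟨ sym (+-assoc (g 0 0 (suc n)) _ _) ⟩
  g 0 0 (suc n) + diagSum n (λ t w → g 0 (suc t) w) + diagSum n (λ u z → diagSum z (λ v w → g (suc u) v w)) ∎

diagSum-split : ∀ x y (g : ℕ → ℕ → ℕ) →
  diagSum (x + y) g ≡ diagSum x (λ s i → ifPos i (g s (i + y))) + diagSum y (λ t w → g (x + t) w)
diagSum-split zero    y g = refl
diagSum-split (suc x) y g =
  trans (cong (g 0 (suc (x + y)) +_) (diagSum-split x y (λ u → g (suc u)))) (sym (+-assoc (g 0 (suc (x + y))) _ _))

diagSum-zero : ∀ n → diagSum n (λ _ _ → 0) ≡ 0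
diagSum-zero zero    = refl
diagSum-zero (suc n) = diagSum-zero n

diagSum-ifPos : ∀ i n (g : ℕ → ℕ → ℕ) → ifPos i (diagSum n g) ≡ diagSum n (λ u v → ifPos i (g u v))
diagSum-ifPos zero    n g = sym (diagSum-zero n)
diagSum-ifPos (suc i) n g = refl

infixl 7 _⋆_

_⋆_ : (ℕ → ℕ) → (ℕ → ℕ) → ℕ → ℕ
(f ⋆ g) n = ∑[ u + v ≡ n ] f u * g v

module _ {f g : ℕ → ℕ} where

  ⋆-congˡ : ∀ {f′} → (∀ m → f m ≡ f′ m) → ∀ n → (f ⋆ g) n ≡ (f′ ⋆ g) n
  ⋆-congˡ e n = diagSum-ext n (λ u v → cong (_* g v) (e u))

  ⋆-congʳ : ∀ {g′} → (∀ m → g m ≡ g′ m) → ∀ n → (f ⋆ g) n ≡ (f ⋆ g′) n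
  ⋆-congʳ e n = diagSum-ext n (λ u v → cong (f u *_) (e v))

module _ (f g : ℕ → ℕ) where

  ⋆-comm : ∀ n → (f ⋆ g) n ≡ (g ⋆ f) n
  ⋆-comm n = trans (diagSum-swap n _) (diagSum-ext n (λ u v → *-comm (f v) (g u)))

  ⋆-headˡ : ∀ n → (f ⋆ g) n ≡ f 0 * g n + (f ⁺ ⋆ g) n
  ⋆-headˡ n = trans (diagSum-headˡ n _) (cong (f 0 * g n +_) (diagSum-ext n ifPos-head))
    where
    ifPos-head : ∀ u v → ifPos u (f u * g v) ≡ (f ⁺) u * g v
    ifPos-head zero    v = refl
    ifPos-head (suc u) v = refl

  ⋆-*ˡ : ∀ c n → ((λ u → c * f u) ⋆ g) n ≡ c * (f ⋆ g) n
  ⋆-*ˡ c n = trans (diagSum-ext n (λ u v → *-assoc c (f u) (g v))) (diagSum-*ˡ n c _)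

  ⋆-distribʳ : ∀ f′ n → ((λ u → f u + f′ u) ⋆ g) n ≡ (f ⋆ g) n + (f′ ⋆ g) n
  ⋆-distribʳ f′ n = trans (diagSum-ext n (λ u v → *-distribʳ-+ (g v) (f u) (f′ u))) (diagSum-+ n _ _)

  ⋆-split : ∀ x t → (f ⋆ g) (x + t) ≡
    (∑[ s + i ≡ x ] ifPos i (f s * g (i + t))) + ((λ u → f (x + u)) ⋆ g) t
  ⋆-split x t = diagSum-split x t _

⋆-assoc : ∀ (f g h : ℕ → ℕ) n → (f ⋆ g ⋆ h) n ≡ (f ⋆ (g ⋆ h)) n
⋆-assoc f g h n = begin
  ∑[ t + w ≡ n ] (f ⋆ g) t * h w
    ≡⟨ diagSum-ext n (λ t w → sym (diagSum-*ʳ t (h w) _)) ⟩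
  ∑[ t + w ≡ n ] ∑[ u + v ≡ t ] f u * g v * h w
    ≡⟨ diagSum-assoc n (λ u v w → f u * g v * h w) ⟩
  ∑[ u + z ≡ n ] ∑[ v + w ≡ z ] f u * g v * h w
    ≡⟨ diagSum-ext n (λ u z → trans (diagSum-ext z (λ v w → *-assoc (f u) (g v) (h w)))
                                     (diagSum-*ˡ z (f u) _)) ⟩
  ∑[ u + z ≡ n ] f u * (g ⋆ h) z
    ∎

⋆-rotate : ∀ (f g h : ℕ → ℕ) n → (f ⋆ g ⋆ h) n ≡ (f ⋆ h ⋆ g) n
⋆-rotate f g h n = begin
  (f ⋆ g ⋆ h) n    ≡⟨ ⋆-assoc f g h n ⟩
  (f ⋆ (g ⋆ h)) n  ≡⟨ ⋆-congʳ {f} (⋆-comm g h) n ⟩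
  (f ⋆ (h ⋆ g)) n  ≡⟨ sym (⋆-assoc f h g n) ⟩
  (f ⋆ h ⋆ g) n    ∎

⋆-lastʳ : ∀ (f g : ℕ → ℕ) n → (f ⋆ g) n ≡ f n * g 0 + (f ⋆ g ⁺) n
⋆-lastʳ f g n = begin
  (f ⋆ g) n                ≡⟨ ⋆-comm f g n ⟩
  (g ⋆ f) n                ≡⟨ ⋆-headˡ g f n ⟩
  g 0 * f n + (g ⁺ ⋆ f) n  ≡⟨ cong₂ _+_ (*-comm (g 0) (f n)) (⋆-comm (g ⁺) f n) ⟩
  f n * g 0 + (f ⋆ g ⁺) n  ∎

sumBelow : ℕ → (ℕ → ℕ) → ℕ
sumBelow zero    f = 0
sumBelow (suc m) f = sumBelow m f + f m

infix 5 sumBelow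
syntax sumBelow m (λ s → e) = ∑[ s < m ] e

sumBelow-cong : ∀ m {f g : ℕ → ℕ} → (∀ s → s < m → f s ≡ g s) → sumBelow m f ≡ sumBelow m g
sumBelow-cong zero    e = refl
sumBelow-cong (suc m) e = cong₂ _+_ (sumBelow-cong m (λ s s<m → e s (m<n⇒m<1+n s<m))) (e m ≤-refl)

sumBelow-⋆ : ∀ (f g : ℕ → ℕ) m → (∑[ s < m ] f s * g (m ∸ s)) ≡ (f ⋆ g ⁺) m
sumBelow-⋆ f g zero    = sym (*-zeroʳ (f 0))
sumBelow-⋆ f g (suc m) = begin
  (∑[ s < m ] f s * g (suc m ∸ s)) + f m * g (suc m ∸ m)
    ≡⟨ cong₂ _+_ (sumBelow-cong m (λ s s<m → cong (λ k → f s * g k) (+-∸-assoc 1 (<⇒≤ s<m))))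
                 (cong (λ k → f m * g k) (m+n∸n≡m 1 m)) ⟩
  (∑[ s < m ] f s * g′ (m ∸ s)) + f m * g′ 0
    ≡⟨ cong (_+ f m * g′ 0) (sumBelow-⋆ f g′ m) ⟩
  (f ⋆ g′ ⁺) m + f m * g′ 0
    ≡⟨ trans (+-comm _ (f m * g′ 0)) (sym (⋆-lastʳ f g′ m)) ⟩
  (f ⋆ g′) m
    ≡⟨ sym (+-identityʳ _) ⟩
  (f ⋆ g′) m + 0
    ≡⟨ cong ((f ⋆ g′) m +_) (sym (*-zeroʳ (f (suc m)))) ⟩
  (f ⋆ g′) m + f (suc m) * 0
    ≡⟨ sym (diagSum-sucʳ m (λ u v → f u * (g ⁺) v)) ⟩
  (f ⋆ g ⁺) (suc m)
    ∎
  where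
  g′ : ℕ → ℕ
  g′ v = g (suc v)

sum1to-cong : ∀ n {f g : ℕ → ℕ} → (∀ i → i ≤ n → f i ≡ g i) → sum1to n f ≡ sum1to n g
sum1to-cong zero    e = refl
sum1to-cong (suc n) e = cong₂ _+_ (sum1to-cong n (λ i i≤n → e i (m≤n⇒m≤1+n i≤n))) (e (suc n) ≤-refl)

sum1to-diagSum : ∀ n (h : ℕ → ℕ → ℕ) → sum1to n (λ i → h (n ∸ i) i) ≡ ∑[ u + i ≡ n ] ifPos i (h u i)
sum1to-diagSum zero    h = refl
sum1to-diagSum (suc n) h = begin
  sum1to n (λ i → h (suc n ∸ i) i) + h (n ∸ n) (suc n)
    ≡⟨ cong₂ _+_ (sum1to-cong n (λ i i≤n → cong (λ u → h u i) (+-∸-assoc 1 i≤n)))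
                 (cong (λ u → h u (suc n)) (n∸n≡0 n)) ⟩
  sum1to n (λ i → h (suc (n ∸ i)) i) + h 0 (suc n)
    ≡⟨ cong (_+ h 0 (suc n)) (sum1to-diagSum n (λ u → h (suc u))) ⟩
  (∑[ u + i ≡ n ] ifPos i (h (suc u) i)) + h 0 (suc n)
    ≡⟨ +-comm _ (h 0 (suc n)) ⟩
  (∑[ u + i ≡ suc n ] ifPos i (h u i))
    ∎

sumBelow-zero : ∀ m → (∑[ s < m ] 0) ≡ 0
sumBelow-zero zero    = refl
sumBelow-zero (suc m) = trans (+-identityʳ _) (sumBelow-zero m)

sumBelow-+ : ∀ m (f g : ℕ → ℕ) → (∑[ s < m ] f s + g s) ≡ sumBelow m f + sumBelow m g
sumBelow-+ zero    f g = refl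
sumBelow-+ (suc m) f g =
  trans (cong (_+ (f m + g m)) (sumBelow-+ m f g)) (+-CS.interchange (sumBelow m f) (sumBelow m g) (f m) (g m))

sumBelow-*ʳ : ∀ m (f : ℕ → ℕ) c → (∑[ s < m ] f s * c) ≡ sumBelow m f * c
sumBelow-*ʳ zero    f c = refl
sumBelow-*ʳ (suc m) f c =
  trans (cong (_+ f m * c) (sumBelow-*ʳ m f c)) (sym (*-distribʳ-+ c (sumBelow m f) (f m)))

sumBelow-*ˡ : ∀ m (f : ℕ → ℕ) c → (∑[ s < m ] c * f s) ≡ c * sumBelow m f
sumBelow-*ˡ m f c = trans (sumBelow-cong m (λ s _ → *-comm c (f s))) (trans (sumBelow-*ʳ m f c) (*-comm _ c))

-- Consequences of the renewal equation

module Renewal (R Q : ℕ → ℕ) (R-zero : R 0 ≡ 1)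
               (renewal : ∀ m → 1 ≤ m → R m ≡ (R ⋆ Q ⁺) m) where

  -- For the tiling sequence, crossing x y counts the tilings of x + y columns that do not break
  -- at x, classified by the unbreakable block through x covering columns x − i + 1, …, x + j.

  straddle : ℕ → ℕ → ℕ
  straddle x j = ∑[ u + i ≡ x ] ifPos i (R u * Q (i + j))

  crossing : ℕ → ℕ → ℕ
  crossing x y = ∑[ u + i ≡ x ] ∑[ v + j ≡ y ] ifPos i (ifPos j (R u * R v * Q (i + j)))

  R⁺≡R⋆Q⁺ : ∀ m → (R ⁺) m ≡ (R ⋆ Q ⁺) m
  R⁺≡R⋆Q⁺ zero    = sym (*-zeroʳ (R 0))
  R⁺≡R⋆Q⁺ (suc m) = renewal (suc m) (s≤s z≤n)

  crossing≡R⋆straddle⁺ : ∀ x y → crossing x y ≡ (R ⋆ straddle x ⁺) y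
  crossing≡R⋆straddle⁺ x y = trans (diagSum-fubini x y _) (diagSum-ext y inner-sum)
    where
    term : ∀ u i v j → ifPos i (ifPos j (R u * R v * Q (i + j))) ≡ R v * ifPos j (ifPos i (R u * Q (i + j)))
    term u zero    v j       = sym (trans (cong (R v *_) (ifPos-zero j)) (*-zeroʳ (R v)))
    term u (suc i) v zero    = sym (*-zeroʳ (R v))
    term u (suc i) v (suc j) = *-CS.xy∙z≈y∙xz (R u) (R v) _
    inner-sum : ∀ v j → (∑[ u + i ≡ x ] ifPos i (ifPos j (R u * R v * Q (i + j)))) ≡ R v * (straddle x ⁺) j
    inner-sum v j = begin
      (∑[ u + i ≡ x ] ifPos i (ifPos j (R u * R v * Q (i + j))))
        ≡⟨ diagSum-ext x (λ u i → term u i v j) ⟩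
      (∑[ u + i ≡ x ] R v * ifPos j (ifPos i (R u * Q (i + j))))
        ≡⟨ diagSum-*ˡ x (R v) _ ⟩
      R v * (∑[ u + i ≡ x ] ifPos j (ifPos i (R u * Q (i + j))))
        ≡⟨ cong (R v *_) (sym (diagSum-ifPos j x _)) ⟩
      R v * (straddle x ⁺) j
        ∎

  crossing-step : ∀ x y → 1 ≤ y → crossing x y ≡ straddle x y + (crossing x ⋆ Q ⁺) y
  crossing-step x y@(suc _) _ = begin
    crossing x y
      ≡⟨ crossing≡R⋆straddle⁺ x y ⟩
    (R ⋆ T⁺) y
      ≡⟨ ⋆-headˡ R T⁺ y ⟩
    R 0 * straddle x y + (R ⁺ ⋆ T⁺) y
      ≡⟨ cong₂ _+_ (trans (cong (_* straddle x y) R-zero) (+-identityʳ _)) (⋆-congˡ R⁺≡R⋆Q⁺ y) ⟩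
    straddle x y + (R ⋆ Q ⁺ ⋆ T⁺) y
      ≡⟨ cong (straddle x y +_) (⋆-rotate R (Q ⁺) T⁺ y) ⟩
    straddle x y + (R ⋆ T⁺ ⋆ Q ⁺) y
      ≡⟨ cong (straddle x y +_) (⋆-congˡ (λ t → sym (crossing≡R⋆straddle⁺ x t)) y) ⟩
    straddle x y + (crossing x ⋆ Q ⁺) y
      ∎
    where
    T⁺ = straddle x ⁺

  R-+ : ∀ x y → R (x + y) ≡ R x * R y + crossing x y
  R-+ x = <-rec (λ y → R (x + y) ≡ R x * R y + crossing x y) step
    where
    step : ∀ t → (∀ {u} → u < t → R (x + u) ≡ R x * R u + crossing x u) →
           R (x + t) ≡ R x * R t + crossing x t
    step zero _ = begin
      R (x + 0)                 ≡⟨ cong R (+-identityʳ x) ⟩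
      R x                       ≡⟨ sym (*-identityʳ (R x)) ⟩
      R x * 1                   ≡⟨ sym (+-identityʳ _) ⟩
      R x * 1 + 0               ≡⟨ cong₂ (λ a b → R x * a + b) (sym R-zero)
                                         (sym (trans (crossing≡R⋆straddle⁺ x 0) (*-zeroʳ (R 0)))) ⟩
      R x * R 0 + crossing x 0  ∎
    step t@(suc _) ih = begin
      R (x + t)
        ≡⟨ renewal (x + t) (subst (1 ≤_) (sym (+-suc x _)) (s≤s z≤n)) ⟩
      (R ⋆ Q ⁺) (x + t)
        ≡⟨ ⋆-split R (Q ⁺) x t ⟩
      (∑[ s + i ≡ x ] ifPos i (R s * (Q ⁺) (i + t))) + ((λ u → R (x + u)) ⋆ Q ⁺) t
        ≡⟨ cong₂ _+_ (diagSum-ext x straddle-term) (diagSum-cong t by-induction) ⟩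
      straddle x t + ((λ u → R x * R u + crossing x u) ⋆ Q ⁺) t
        ≡⟨ cong (straddle x t +_) (trans (⋆-distribʳ (λ u → R x * R u) (Q ⁺) (crossing x) t)
                                         (cong (_+ (crossing x ⋆ Q ⁺) t) (⋆-*ˡ R (Q ⁺) (R x) t))) ⟩
      straddle x t + (R x * (R ⋆ Q ⁺) t + (crossing x ⋆ Q ⁺) t)
        ≡⟨ cong (λ z → straddle x t + (R x * z + (crossing x ⋆ Q ⁺) t)) (sym (renewal t (s≤s z≤n))) ⟩
      straddle x t + (R x * R t + (crossing x ⋆ Q ⁺) t)
        ≡⟨ +-CS.x∙yz≈y∙xz (straddle x t) (R x * R t) _ ⟩
      R x * R t + (straddle x t + (crossing x ⋆ Q ⁺) t)
        ≡⟨ cong (R x * R t +_) (sym (crossing-step x t (s≤s z≤n))) ⟩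
      R x * R t + crossing x t
        ∎
      where
      straddle-term : ∀ s i → ifPos i (R s * (Q ⁺) (i + t)) ≡ ifPos i (R s * Q (i + t))
      straddle-term s zero    = refl
      straddle-term s (suc i) = refl
      by-induction : ∀ u w → u + w ≡ t → R (x + u) * (Q ⁺) w ≡ (R x * R u + crossing x u) * (Q ⁺) w
      by-induction u zero    _  = trans (*-zeroʳ (R (x + u))) (sym (*-zeroʳ (R x * R u + crossing x u)))
      by-induction u (suc w) eq = cong (_* Q (suc w)) (ih (subst (u <_) eq (m<m+n u z<s)))

  crossing-sum1to : ∀ x y →
    sum1to x (λ i → sum1to y (λ j → R (x ∸ i) * R (y ∸ j) * Q (i + j))) ≡ crossing x y
  crossing-sum1to x y =
    trans (sum1to-diagSum x (λ u i → sum1to y (λ j → R u * R (y ∸ j) * Q (i + j))))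
          (diagSum-ext x inner)
    where
    inner : ∀ u i → ifPos i (sum1to y (λ j → R u * R (y ∸ j) * Q (i + j))) ≡
                    (∑[ v + j ≡ y ] ifPos i (ifPos j (R u * R v * Q (i + j))))
    inner u i = trans (cong (ifPos i) (sum1to-diagSum y (λ v j → R u * R v * Q (i + j))))
                      (diagSum-ifPos i y _)

private
  variable
    A B : Set

sumOver : List A → (A → ℕ) → ℕ
sumOver []       h = 0
sumOver (x ∷ xs) h = h x + sumOver xs h

infix 5 sumOver
syntax sumOver xs (λ x → e) = ∑[ x ∈ xs ] e

iverson : Bool → ℕ
iverson true  = 1
iverson false = 0

iverson-∧ : ∀ x y → iverson (x ∧ y) ≡ iverson x * iverson y
iverson-∧ true  y = sym (+-identityʳ (iverson y))
iverson-∧ false y = refl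

length-filterᵇ : ∀ (p : A → Bool) xs → length (filterᵇ p xs) ≡ ∑[ x ∈ xs ] iverson (p x)
length-filterᵇ p []       = refl
length-filterᵇ p (x ∷ xs) with p x
... | true  = cong suc (length-filterᵇ p xs)
... | false = length-filterᵇ p xs

sumOver-cong : ∀ xs {g h : A → ℕ} → (∀ x → g x ≡ h x) → sumOver xs g ≡ sumOver xs h
sumOver-cong []       e = refl
sumOver-cong (x ∷ xs) e = cong₂ _+_ (e x) (sumOver-cong xs e)

sumOver-zero : ∀ xs {h : A → ℕ} → (∀ x → h x ≡ 0) → sumOver xs h ≡ 0
sumOver-zero []       e = refl
sumOver-zero (x ∷ xs) e = cong₂ _+_ (e x) (sumOver-zero xs e)

sumOver-++ : ∀ xs ys (h : A → ℕ) → sumOver (xs ++ ys) h ≡ sumOver xs h + sumOver ys h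
sumOver-++ []       ys h = refl
sumOver-++ (x ∷ xs) ys h = trans (cong (h x +_) (sumOver-++ xs ys h)) (sym (+-assoc (h x) _ _))

sumOver-*ˡ : ∀ xs c (h : A → ℕ) → (∑[ x ∈ xs ] c * h x) ≡ c * sumOver xs h
sumOver-*ˡ []       c h = sym (*-zeroʳ c)
sumOver-*ˡ (x ∷ xs) c h = trans (cong (c * h x +_) (sumOver-*ˡ xs c h)) (sym (*-distribˡ-+ c _ _))

sumOver-*ʳ : ∀ xs c (h : A → ℕ) → (∑[ x ∈ xs ] h x * c) ≡ sumOver xs h * c
sumOver-*ʳ xs c h = trans (sumOver-cong xs (λ x → *-comm (h x) c)) (trans (sumOver-*ˡ xs c h) (*-comm c _))

sumOver-map : ∀ (f : A → B) xs (h : B → ℕ) → sumOver (map f xs) h ≡ ∑[ x ∈ xs ] h (f x)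
sumOver-map f []       h = refl
sumOver-map f (x ∷ xs) h = cong (h (f x) +_) (sumOver-map f xs h)

sumOver-concatMap : ∀ (f : A → List B) xs h → sumOver (concatMap f xs) h ≡ ∑[ x ∈ xs ] sumOver (f x) h
sumOver-concatMap f []       h = refl
sumOver-concatMap f (x ∷ xs) h =
  trans (sumOver-++ (f x) (concatMap f xs) h) (cong (sumOver (f x) h +_) (sumOver-concatMap f xs h))

sumOver-cartesianProduct : ∀ (xs : List A) (ys : List B) h →
  sumOver (cartesianProduct xs ys) h ≡ ∑[ x ∈ xs ] ∑[ y ∈ ys ] h (x , y)
sumOver-cartesianProduct []       ys h = refl
sumOver-cartesianProduct (x ∷ xs) ys h =
  trans (sumOver-++ (map (x ,_) ys) _ h)
        (cong₂ _+_ (sumOver-map (x ,_) ys h) (sumOver-cartesianProduct xs ys h))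

sumOver-* : ∀ (xs : List A) (ys : List B) f g → (∑[ x ∈ xs ] ∑[ y ∈ ys ] f x * g y) ≡ sumOver xs f * sumOver ys g
sumOver-* xs ys f g = trans (sumOver-cong xs (λ x → sumOver-*ˡ ys (f x) g)) (sumOver-*ʳ xs (sumOver ys g) f)

sumOver-tabulate-cong : ∀ n {f : Fin n → A} {g : Fin n → B} {h h′} → (∀ i → h (f i) ≡ h′ (g i)) →
  sumOver (tabulate f) h ≡ sumOver (tabulate g) h′
sumOver-tabulate-cong zero    e = refl
sumOver-tabulate-cong (suc n) e = cong₂ _+_ (e fzero) (sumOver-tabulate-cong n (λ i → e (fsuc i)))

sumOver-tabulate-+ : ∀ s r (f : Fin (s + r) → A) h →
  sumOver (tabulate f) h ≡ sumOver (tabulate (λ i → f (i ↑ˡ r))) h + sumOver (tabulate (λ i → f (s ↑ʳ i))) h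
sumOver-tabulate-+ zero    r f h = refl
sumOver-tabulate-+ (suc s) r f h =
  trans (cong (h (f fzero) +_) (sumOver-tabulate-+ s r (λ i → f (fsuc i)) h)) (sym (+-assoc (h (f fzero)) _ _))

sumOver-allFin-+ : ∀ s r (h : Fin (s + r) → ℕ) →
  sumOver (allFin (s + r)) h ≡ (∑[ i ∈ allFin s ] h (i ↑ˡ r)) + (∑[ i ∈ allFin r ] h (s ↑ʳ i))
sumOver-allFin-+ s r h =
  trans (sumOver-tabulate-+ s r (λ i → i) h)
        (cong₂ _+_ (sumOver-tabulate-cong s (λ _ → refl)) (sumOver-tabulate-cong r (λ _ → refl)))

sumOver-sumBelow : ∀ (xs : List A) m (g : A → ℕ → ℕ) →
  (∑[ x ∈ xs ] ∑[ s < m ] g x s) ≡ (∑[ s < m ] ∑[ x ∈ xs ] g x s)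
sumOver-sumBelow []       m g = sym (sumBelow-zero m)
sumOver-sumBelow (x ∷ xs) m g =
  trans (cong (sumBelow m (g x) +_) (sumOver-sumBelow xs m g)) (sym (sumBelow-+ m (g x) _))

↑-elim : ∀ s {r} (P : Fin (s + r) → Set) → (∀ i → P (i ↑ˡ r)) → (∀ i → P (s ↑ʳ i)) → ∀ j → P j
↑-elim s P left right j with splitAt s j in eq
... | inj₁ i = subst P (splitAt⁻¹-↑ˡ eq) (left i)
... | inj₂ i = subst P (splitAt⁻¹-↑ʳ eq) (right i)

module _ {A : Set} (_≈_ : Rel A 0ℓ) (≈-refl : Reflexive _≈_) where

  private
    _≋_ : ∀ {k} → Rel (Vector A k) 0ℓ
    _≋_ = Pointwise _≈_

  ∷ᵛ-cong : ∀ {k x y} {F G : Vector A k} → x ≈ y → F ≋ G → (x ∷ᵛ F) ≋ (y ∷ᵛ G)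
  ∷ᵛ-cong x≈y F≋G fzero    = x≈y
  ∷ᵛ-cong x≈y F≋G (fsuc i) = F≋G i

  ++ᵛ-cong : ∀ s {r} {F₁ G₁ : Vector A s} {F₂ G₂ : Vector A r} → F₁ ≋ G₁ → F₂ ≋ G₂ → (F₁ ++ᵛ F₂) ≋ (G₁ ++ᵛ G₂)
  ++ᵛ-cong s e₁ e₂ j with splitAt s j
  ... | inj₁ i = e₁ i
  ... | inj₂ i = e₂ i

  ∷ᵛ-++ᵛ : ∀ {s r} x (F₁ : Vector A s) (F₂ : Vector A r) → (x ∷ᵛ (F₁ ++ᵛ F₂)) ≋ ((x ∷ᵛ F₁) ++ᵛ F₂)
  ∷ᵛ-++ᵛ x F₁ F₂ fzero = ≈-refl
  ∷ᵛ-++ᵛ {s} x F₁ F₂ (fsuc j) with splitAt s j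
  ... | inj₁ i = ≈-refl
  ... | inj₂ i = ≈-refl

  sumOver-allFuns-suc : ∀ k xs (h : Vector A (suc k) → ℕ) → h Preserves _≋_ ⟶ _≡_ →
    sumOver (allFuns (suc k) xs) h ≡ ∑[ x ∈ xs ] ∑[ F ∈ allFuns k xs ] h (x ∷ᵛ F)
  sumOver-allFuns-suc k xs h h-resp =
    trans (sumOver-concatMap _ xs h)
          (sumOver-cong xs (λ x → trans (sumOver-map _ (allFuns k xs) h)
            (sumOver-cong (allFuns k xs) (λ F → h-resp (λ { fzero → ≈-refl ; (fsuc i) → ≈-refl })))))

  sumOver-allFuns-+ : ∀ s r xs (h : Vector A (s + r) → ℕ) → h Preserves _≋_ ⟶ _≡_ →
    sumOver (allFuns (s + r) xs) h ≡ ∑[ F₁ ∈ allFuns s xs ] ∑[ F₂ ∈ allFuns r xs ] h (F₁ ++ᵛ F₂)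
  sumOver-allFuns-+ zero    r xs h h-resp = sym (+-identityʳ _)
  sumOver-allFuns-+ (suc s) r xs h h-resp = begin
    sumOver (allFuns (suc (s + r)) xs) h
      ≡⟨ sumOver-allFuns-suc (s + r) xs h h-resp ⟩
    (∑[ x ∈ xs ] ∑[ F ∈ allFuns (s + r) xs ] h (x ∷ᵛ F))
      ≡⟨ sumOver-cong xs (λ x → sumOver-allFuns-+ s r xs (λ F → h (x ∷ᵛ F)) (λ e → h-resp (∷ᵛ-cong ≈-refl e))) ⟩
    (∑[ x ∈ xs ] ∑[ F₁ ∈ allFuns s xs ] ∑[ F₂ ∈ allFuns r xs ] h (x ∷ᵛ (F₁ ++ᵛ F₂)))
      ≡⟨ sumOver-cong xs (λ x → sumOver-cong (allFuns s xs) (λ F₁ → sumOver-cong (allFuns r xs) (λ F₂ →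
           h-resp (∷ᵛ-++ᵛ x F₁ F₂)))) ⟩
    (∑[ x ∈ xs ] ∑[ F₁ ∈ allFuns s xs ] ∑[ F₂ ∈ allFuns r xs ] h ((x ∷ᵛ F₁) ++ᵛ F₂))
      ≡⟨ sym (sumOver-allFuns-suc s xs _ (λ e → sumOver-cong (allFuns r xs) (λ F₂ →
           h-resp (++ᵛ-cong (suc s) e (λ _ → ≈-refl))))) ⟩
    (∑[ F₁ ∈ allFuns (suc s) xs ] ∑[ F₂ ∈ allFuns r xs ] h (F₁ ++ᵛ F₂))
      ∎

SumTransfer : {A B : Set} → Rel A 0ℓ → (A → Set) → List A → List B → (B → A) → Set
SumTransfer {A} _≈_ Bad xs ys σ =
  ∀ (h : A → ℕ) → h Preserves _≈_ ⟶ _≡_ → (∀ a → Bad a → h a ≡ 0) → sumOver xs h ≡ ∑[ y ∈ ys ] h (σ y)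

SumTransfer-allFuns : ∀ {A B : Set} {_≈_ : Rel A 0ℓ} (≈-refl : Reflexive _≈_) {Bad xs ys} {σ : B → A} →
  SumTransfer _≈_ Bad xs ys σ → ∀ k →
  SumTransfer (Pointwise _≈_) (Any Bad) (allFuns k xs) (allFuns k ys) (σ ∘_)
SumTransfer-allFuns ≈-refl tr zero    h h-resp h-bad = cong (_+ 0) (h-resp (λ ()))
SumTransfer-allFuns {_≈_ = _≈_} ≈-refl {Bad} {xs} {ys} {σ} tr (suc k) h h-resp h-bad = begin
  sumOver (allFuns (suc k) xs) h
    ≡⟨ sumOver-allFuns-suc _≈_ ≈-refl k xs h h-resp ⟩
  (∑[ x ∈ xs ] ∑[ F ∈ allFuns k xs ] h (x ∷ᵛ F))
    ≡⟨ tr _ (λ x≈x′ → sumOver-cong (allFuns k xs) (λ F → h-resp (∷ᵛ-cong _≈_ ≈-refl x≈x′ (λ _ → ≈-refl))))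
            (λ x bad → sumOver-zero (allFuns k xs) (λ F → h-bad (x ∷ᵛ F) (fzero , bad))) ⟩
  (∑[ y ∈ ys ] ∑[ F ∈ allFuns k xs ] h (σ y ∷ᵛ F))
    ≡⟨ sumOver-cong ys (λ y → SumTransfer-allFuns ≈-refl tr k (λ F → h (σ y ∷ᵛ F))
         (λ e → h-resp (∷ᵛ-cong _≈_ ≈-refl ≈-refl e)) (λ F (i , bad) → h-bad (σ y ∷ᵛ F) (fsuc i , bad))) ⟩
  (∑[ y ∈ ys ] ∑[ G ∈ allFuns k ys ] h (σ y ∷ᵛ (σ ∘ G)))
    ≡⟨ sumOver-cong ys (λ y → sumOver-cong (allFuns k ys) (λ G →
         h-resp (λ { fzero → ≈-refl ; (fsuc i) → ≈-refl }))) ⟩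
  (∑[ y ∈ ys ] ∑[ G ∈ allFuns k ys ] h (σ ∘ (y ∷ᵛ G)))
    ≡⟨ sym (sumOver-allFuns-suc _≡_ refl k ys (λ G → h (σ ∘ G))
              (λ e → h-resp (λ i → subst (λ a → σ _ ≈ σ a) (e i) ≈-refl))) ⟩
  (∑[ G ∈ allFuns (suc k) ys ] h (σ ∘ G))
    ∎

bool-ext : ∀ {x y : Bool} → (x ≡ true → y ≡ true) → (y ≡ true → x ≡ true) → x ≡ y
bool-ext {false} {false} _ _ = refl
bool-ext {false} {true}  _ g = g refl
bool-ext {true}  {false} f _ = sym (f refl)
bool-ext {true}  {true}  _ _ = refl

module _ {p : A → Bool} where

  allB-elim : ∀ xs → allB p xs ≡ true → ∀ {x} → x ∈ xs → p x ≡ true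
  allB-elim (y ∷ xs) e (here refl) = ∧-conicalˡ (p y) _ e
  allB-elim (y ∷ xs) e (there x∈xs) = allB-elim xs (∧-conicalʳ (p y) _ e) x∈xs

  allB-false : ∀ xs → allB p xs ≡ false → ∃[ x ] p x ≡ false
  allB-false (y ∷ xs) e with p y in eq
  ... | false = y , eq
  ... | true  = allB-false xs e

  anyB-intro : ∀ xs {x} → x ∈ xs → p x ≡ true → anyB p xs ≡ true
  anyB-intro (y ∷ xs) (here refl) e rewrite e = refl
  anyB-intro (y ∷ xs) (there x∈xs) e with p y
  ... | true  = refl
  ... | false = anyB-intro xs x∈xs e

  anyB-elim : ∀ xs → anyB p xs ≡ true → ∃[ x ] p x ≡ true
  anyB-elim (y ∷ xs) e with p y in eq
  ... | true  = y , eq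
  ... | false = anyB-elim xs e

  anyB-false : ∀ xs → (∀ x → p x ≡ false) → anyB p xs ≡ false
  anyB-false []       e = refl
  anyB-false (x ∷ xs) e rewrite e x = anyB-false xs e

module _ {p p′ : A → Bool} (e : ∀ x → p x ≡ p′ x) where

  allB-cong : ∀ xs → allB p xs ≡ allB p′ xs
  allB-cong []       = refl
  allB-cong (x ∷ xs) = cong₂ _∧_ (e x) (allB-cong xs)

  anyB-cong : ∀ xs → anyB p xs ≡ anyB p′ xs
  anyB-cong []       = refl
  anyB-cong (x ∷ xs) = cong₂ _∨_ (e x) (anyB-cong xs)

<ᵇ-true : ∀ {m n} → m < n → (m <ᵇ n) ≡ true
<ᵇ-true m<n = Equivalence.to T-≡ (<⇒<ᵇ m<n)

<ᵇ-false : ∀ {m n} → n ≤ m → (m <ᵇ n) ≡ false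
<ᵇ-false {m} {n} n≤m with m <ᵇ n in eq
... | false = refl
... | true  = contradiction (<ᵇ⇒< m n (Equivalence.from T-≡ eq)) (≤⇒≯ n≤m)

-- The last breaking position

-- positions k lists 1, …, k − 1, so lastBelow B m s says that s is the last of 0, …, m − 1 where B holds.
lastBelow : (ℕ → Bool) → ℕ → ℕ → Bool
lastBelow B m s = B s ∧ allB (λ i → not (B (s + i))) (positions (m ∸ s))

allB-positions-suc : ∀ (p : ℕ → Bool) k → 1 ≤ k → allB p (positions (suc k)) ≡ allB p (positions k) ∧ p k
allB-positions-suc p (suc k) _ = snoc k (λ i → i)
  where
  snoc : ∀ n (f : ℕ → ℕ) → allB p (map suc (applyUpTo f (suc n))) ≡ allB p (map suc (applyUpTo f n)) ∧ p (suc (f n))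
  snoc zero    f = ∧-identityʳ _
  snoc (suc n) f =
    trans (cong (p (suc (f 0)) ∧_) (snoc n (λ k → f (suc k)))) (sym (∧-assoc (p (suc (f 0))) _ _))

module _ (B : ℕ → Bool) where

  lastBelow-suc : ∀ {m s} → s < m → lastBelow B (suc m) s ≡ lastBelow B m s ∧ not (B m)
  lastBelow-suc {m} {s} s<m = begin
    B s ∧ allB P (positions (suc m ∸ s))
      ≡⟨ cong (λ k → B s ∧ allB P (positions k)) (+-∸-assoc 1 (<⇒≤ s<m)) ⟩
    B s ∧ allB P (positions (suc (m ∸ s)))
      ≡⟨ cong (B s ∧_) (allB-positions-suc P (m ∸ s) (m<n⇒0<n∸m s<m)) ⟩
    B s ∧ (allB P (positions (m ∸ s)) ∧ not (B (s + (m ∸ s))))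
      ≡⟨ cong (λ k → B s ∧ (allB P (positions (m ∸ s)) ∧ not (B k))) (m+[n∸m]≡n (<⇒≤ s<m)) ⟩
    B s ∧ (allB P (positions (m ∸ s)) ∧ not (B m))
      ≡⟨ sym (∧-assoc (B s) _ _) ⟩
    lastBelow B m s ∧ not (B m)
      ∎
    where
    P = λ i → not (B (s + i))

  lastBelow-self : ∀ m → lastBelow B (suc m) m ≡ B m
  lastBelow-self m = trans (cong (λ k → B m ∧ allB (λ i → not (B (m + i))) (positions k)) (m+n∸n≡m 1 m))
                           (∧-identityʳ (B m))

  sumBelow-lastBelow : B 0 ≡ true → ∀ m → 1 ≤ m → (∑[ s < m ] iverson (lastBelow B m s)) ≡ 1
  sumBelow-lastBelow B0 (suc zero) _ rewrite B0 = refl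
  sumBelow-lastBelow B0 (suc m@(suc _)) _ = begin
    (∑[ s < m ] iverson (lastBelow B (suc m) s)) + iverson (lastBelow B (suc m) m)
      ≡⟨ cong₂ _+_ (sumBelow-cong m (λ s s<m → trans (cong iverson (lastBelow-suc s<m))
                                                     (iverson-∧ (lastBelow B m s) (not (B m)))))
                   (cong iverson (lastBelow-self m)) ⟩
    (∑[ s < m ] iverson (lastBelow B m s) * iverson (not (B m))) + iverson (B m)
      ≡⟨ cong (_+ iverson (B m)) (sumBelow-*ʳ m _ (iverson (not (B m)))) ⟩
    (∑[ s < m ] iverson (lastBelow B m s)) * iverson (not (B m)) + iverson (B m)
      ≡⟨ cong (λ k → k * iverson (not (B m)) + iverson (B m)) (sumBelow-lastBelow B0 m (s≤s z≤n)) ⟩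
    1 * iverson (not (B m)) + iverson (B m)
      ≡⟨ exactly-one (B m) ⟩
    1
      ∎
    where
    exactly-one : ∀ x → 1 * iverson (not x) + iverson x ≡ 1
    exactly-one true  = refl
    exactly-one false = refl

-- Tilings of the board

module Board (q a b : ℕ) where

  coherent : ∀ {n} → Assignment q n a b → Cell q n → Label q n a b → Bool
  coherent f x (inj₁ _)       = true
  coherent f x (inj₂ (y , c)) = adjacent q x y ∧ labelIs q (f y) x c

  ∈-allCells : ∀ {n} (x : Cell q n) → x ∈ allCells q n
  ∈-allCells (j , p) = ∈-cartesianProduct⁺ (∈-allFin j) (∈-allFin p)

  module _ {n} (f : Assignment q n a b) where

    isTiling⇒coherent : isTiling q n a b f ≡ true → ∀ x → coherent f x (f x) ≡ true
    isTiling⇒coherent tiling x with f x | allB-elim (allCells q n) tiling (∈-allCells x)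
    ... | inj₁ _ | _  = refl
    ... | inj₂ _ | ok = ok

    -- The test inside isTiling is defined by `with f x`, so it agrees with coherent only after
    -- splitting on f x; hence the detour through a failing cell.
    coherent⇒isTiling : (∀ x → coherent f x (f x) ≡ true) → isTiling q n a b f ≡ true
    coherent⇒isTiling all-ok with isTiling q n a b f in eq
    ... | true  = refl
    ... | false with allB-false (allCells q n) eq
    ...   | x , not-ok with f x | not-ok | all-ok x
    ...     | inj₁ _ | () | _
    ...     | inj₂ _ | not-ok′ | ok with trans (sym not-ok′) ok
    ...       | ()

  crossesAt : ∀ {n} → Assignment q n a b → ℕ → Bool
  crossesAt {n} f i = anyB (λ x → crosses q i x (f x)) (allCells q n)

  module _ {n} {f g : Assignment q n a b} (f≗g : ∀ x → f x ≡ g x) where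

    coherent-cong : ∀ x ℓ → coherent f x ℓ ≡ coherent g x ℓ
    coherent-cong x (inj₁ _)       = refl
    coherent-cong x (inj₂ (y , c)) = cong (λ ℓ → adjacent q x y ∧ labelIs q ℓ x c) (f≗g y)

    isTiling-cong : isTiling q n a b f ≡ isTiling q n a b g
    isTiling-cong = bool-ext
      (λ t → coherent⇒isTiling g (λ x → trans (sym (coherent-at x)) (isTiling⇒coherent f t x)))
      (λ t → coherent⇒isTiling f (λ x → trans (coherent-at x) (isTiling⇒coherent g t x)))
      where
      coherent-at : ∀ x → coherent f x (f x) ≡ coherent g x (g x)
      coherent-at x = trans (cong (coherent f x) (f≗g x)) (coherent-cong x (g x))

    breakableAt-cong : ∀ i → breakableAt q n a b f i ≡ breakableAt q n a b g i
    breakableAt-cong i = cong not (anyB-cong (λ x → cong (crosses q i x) (f≗g x)) (allCells q n))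

  breakableAt-zero : ∀ {n} (f : Assignment q n a b) → breakableAt q n a b f 0 ≡ true
  breakableAt-zero {n} f = cong not (anyB-false (allCells q n) (λ x → crosses-zero x (f x)))
    where
    crosses-zero : ∀ x (ℓ : Label q n a b) → crosses q 0 x ℓ ≡ false
    crosses-zero x (inj₁ _) = refl
    crosses-zero x (inj₂ _) = refl

  shiftˡ : ∀ {s} r → Label q s a b → Label q (s + r) a b
  shiftˡ r (inj₁ c)             = inj₁ c
  shiftˡ r (inj₂ ((j , p) , c)) = inj₂ ((j ↑ˡ r , p) , c)

  shiftʳ : ∀ s {r} → Label q r a b → Label q (s + r) a b
  shiftʳ s (inj₁ c)             = inj₁ c
  shiftʳ s (inj₂ ((j , p) , c)) = inj₂ ((s ↑ʳ j , p) , c)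

  PartnerIn : ∀ {n} → (ℕ → Set) → Label q n a b → Set
  PartnerIn P (inj₁ _)             = ⊥
  PartnerIn P (inj₂ ((j , _) , _)) = P (toℕ j)

  dominoesAt : ∀ {n} → (Label q n a b → ℕ) → Fin n → ℕ
  dominoesAt h j = ∑[ p ∈ allFin (q ∸ 2) ] ∑[ c ∈ allFin b ] h (inj₂ ((j , p) , c))

  sumOver-allLabels : ∀ n (h : Label q n a b → ℕ) →
    sumOver (allLabels q n a b) h ≡ (∑[ c ∈ allFin a ] h (inj₁ c)) + (∑[ j ∈ allFin n ] dominoesAt h j)
  sumOver-allLabels n h =
    trans (sumOver-++ (map inj₁ (allFin a)) _ h)
      (cong₂ _+_ (sumOver-map inj₁ (allFin a) h)
        (trans (sumOver-map inj₂ (cartesianProduct (allCells q n) (allFin b)) h)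
          (trans (sumOver-cartesianProduct (allCells q n) (allFin b) (λ z → h (inj₂ z)))
            (sumOver-cartesianProduct (allFin n) (allFin (q ∸ 2)) _))))

  dominoesAt-zero : ∀ {n} (h : Label q n a b → ℕ) {P} → (∀ ℓ → PartnerIn P ℓ → h ℓ ≡ 0) →
    ∀ j → P (toℕ j) → dominoesAt h j ≡ 0
  dominoesAt-zero h h-bad j Pj =
    sumOver-zero (allFin (q ∸ 2)) (λ p → sumOver-zero (allFin b) (λ c → h-bad (inj₂ ((j , p) , c)) Pj))

  module _ (s r : ℕ) where

    shiftˡ-transfer : SumTransfer _≡_ (PartnerIn (s ≤_)) (allLabels q (s + r) a b) (allLabels q s a b) (shiftˡ r)
    shiftˡ-transfer h _ h-bad = begin
      sumOver (allLabels q (s + r) a b) h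
        ≡⟨ sumOver-allLabels (s + r) h ⟩
      singles + (∑[ j ∈ allFin (s + r) ] dominoesAt h j)
        ≡⟨ cong (singles +_) (sumOver-allFin-+ s r (dominoesAt h)) ⟩
      singles + ((∑[ i ∈ allFin s ] dominoesAt h (i ↑ˡ r)) + (∑[ i ∈ allFin r ] dominoesAt h (s ↑ʳ i)))
        ≡⟨ cong (λ z → singles + ((∑[ i ∈ allFin s ] dominoesAt h (i ↑ˡ r)) + z))
                (sumOver-zero (allFin r) (λ i → dominoesAt-zero h h-bad (s ↑ʳ i) (right-part i))) ⟩
      singles + ((∑[ i ∈ allFin s ] dominoesAt h (i ↑ˡ r)) + 0)
        ≡⟨ cong (singles +_) (+-identityʳ _) ⟩
      singles + (∑[ i ∈ allFin s ] dominoesAt h (i ↑ˡ r))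
        ≡⟨ sym (sumOver-allLabels s (λ ℓ → h (shiftˡ r ℓ))) ⟩
      (∑[ ℓ ∈ allLabels q s a b ] h (shiftˡ r ℓ))
        ∎
      where
      singles = ∑[ c ∈ allFin a ] h (inj₁ c)
      right-part : ∀ i → s ≤ toℕ (s ↑ʳ i)
      right-part i = subst (s ≤_) (sym (toℕ-↑ʳ s i)) (m≤m+n s (toℕ i))

    shiftʳ-transfer : SumTransfer _≡_ (PartnerIn (_< s)) (allLabels q (s + r) a b) (allLabels q r a b) (shiftʳ s)
    shiftʳ-transfer h _ h-bad = begin
      sumOver (allLabels q (s + r) a b) h
        ≡⟨ sumOver-allLabels (s + r) h ⟩
      singles + (∑[ j ∈ allFin (s + r) ] dominoesAt h j)
        ≡⟨ cong (singles +_) (sumOver-allFin-+ s r (dominoesAt h)) ⟩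
      singles + ((∑[ i ∈ allFin s ] dominoesAt h (i ↑ˡ r)) + (∑[ i ∈ allFin r ] dominoesAt h (s ↑ʳ i)))
        ≡⟨ cong (λ z → singles + (z + (∑[ i ∈ allFin r ] dominoesAt h (s ↑ʳ i))))
                (sumOver-zero (allFin s) (λ i → dominoesAt-zero h h-bad (i ↑ˡ r) (left-part i))) ⟩
      singles + (∑[ i ∈ allFin r ] dominoesAt h (s ↑ʳ i))
        ≡⟨ sym (sumOver-allLabels r (λ ℓ → h (shiftʳ s ℓ))) ⟩
      (∑[ ℓ ∈ allLabels q r a b ] h (shiftʳ s ℓ))
        ∎
      where
      singles = ∑[ c ∈ allFin a ] h (inj₁ c)
      left-part : ∀ i → toℕ (i ↑ˡ r) < s
      left-part i = subst (_< s) (sym (toℕ-↑ˡ i r)) (toℕ<n i)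

  adjacent-↑ˡ : ∀ {s} r (i j : Fin s) p p′ → adjacent q (i ↑ˡ r , p) (j ↑ˡ r , p′) ≡ adjacent q (i , p) (j , p′)
  adjacent-↑ˡ r i j p p′ rewrite toℕ-↑ˡ i r | toℕ-↑ˡ j r = refl

  adjacent-↑ʳ : ∀ s {r} (i j : Fin r) p p′ → adjacent q (s ↑ʳ i , p) (s ↑ʳ j , p′) ≡ adjacent q (i , p) (j , p′)
  adjacent-↑ʳ zero    i j p p′ = refl
  adjacent-↑ʳ (suc s) i j p p′ = adjacent-↑ʳ s i j p p′

  labelIs-shiftˡ : ∀ {s} r (i : Fin s) p ℓ c → labelIs q (shiftˡ r ℓ) (i ↑ˡ r , p) c ≡ labelIs q ℓ (i , p) c
  labelIs-shiftˡ r i p (inj₁ _)              c = refl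
  labelIs-shiftˡ r i p (inj₂ ((j , p′) , _)) c rewrite toℕ-↑ˡ i r | toℕ-↑ˡ j r = refl

  labelIs-shiftʳ : ∀ s {r} (i : Fin r) p ℓ c → labelIs q (shiftʳ s ℓ) (s ↑ʳ i , p) c ≡ labelIs q ℓ (i , p) c
  labelIs-shiftʳ s       i p (inj₁ _) c = refl
  labelIs-shiftʳ zero    i p (inj₂ _) c = refl
  labelIs-shiftʳ (suc s) i p (inj₂ ℓ) c = labelIs-shiftʳ s i p (inj₂ ℓ) c

  crosses-shiftˡ : ∀ s {r} i (k : Fin s) p (ℓ : Label q s a b) → crosses q (s + i) (k ↑ˡ r , p) (shiftˡ r ℓ) ≡ false
  crosses-shiftˡ s {r} i k p (inj₁ _) = refl
  crosses-shiftˡ s {r} i k p (inj₂ ((j , _) , _))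
    rewrite toℕ-↑ˡ k r | toℕ-↑ˡ j r
          | <ᵇ-true (≤-trans (toℕ<n k) (m≤m+n s i)) | <ᵇ-true (≤-trans (toℕ<n j) (m≤m+n s i)) = refl

  crosses-shiftʳ : ∀ s {r} i (k : Fin r) p ℓ → crosses q (s + i) (s ↑ʳ k , p) (shiftʳ s ℓ) ≡ crosses q i (k , p) ℓ
  crosses-shiftʳ s       i k p (inj₁ _) = refl
  crosses-shiftʳ zero    i k p (inj₂ _) = refl
  crosses-shiftʳ (suc s) i k p (inj₂ ℓ) = crosses-shiftʳ s i k p (inj₂ ℓ)

  crosses-partnerRight : ∀ s r (k : Fin s) p (ℓ : Label q (s + r) a b) → PartnerIn (s ≤_) ℓ →
    crosses q s (k ↑ˡ r , p) ℓ ≡ true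
  crosses-partnerRight s r k p (inj₂ ((j , _) , _)) s≤j
    rewrite toℕ-↑ˡ k r | <ᵇ-true (toℕ<n k) | <ᵇ-false s≤j = refl

  crosses-partnerLeft : ∀ s r (k : Fin r) p (ℓ : Label q (s + r) a b) → PartnerIn (_< s) ℓ →
    crosses q s (s ↑ʳ k , p) ℓ ≡ true
  crosses-partnerLeft s r k p (inj₂ ((j , _) , _)) j<s
    rewrite toℕ-↑ʳ s k | <ᵇ-false (m≤m+n s (toℕ k)) | <ᵇ-true j<s = refl

  Column : ℕ → Set
  Column n = Vector (Label q n a b) (q ∸ 2)

  Grid : ℕ → Set
  Grid n = Vector (Column n) n

  cells : ∀ {n} → Grid n → Assignment q n a b
  cells F (j , p) = F j p

  tiling : ∀ {n} → Grid n → Bool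
  tiling {n} F = isTiling q n a b (cells F)

  unbreakable : ∀ {n} → Grid n → Bool
  unbreakable {n} F = isUnbreakable q n a b (cells F)

  glue : ∀ {s r} → Grid s → Grid r → Grid (s + r)
  glue {s} {r} G₁ G₂ = ((shiftˡ r ∘_) ∘ G₁) ++ᵛ ((shiftʳ s ∘_) ∘ G₂)

  module Gluing {s r} (G₁ : Grid s) (G₂ : Grid r) where

    private
      f = cells (glue G₁ G₂)

    glue-↑ˡ : ∀ i p → f (i ↑ˡ r , p) ≡ shiftˡ r (G₁ i p)
    glue-↑ˡ i p = cong (λ column → column p) (lookup-++ˡ ((shiftˡ r ∘_) ∘ G₁) ((shiftʳ s ∘_) ∘ G₂) i)

    glue-↑ʳ : ∀ i p → f (s ↑ʳ i , p) ≡ shiftʳ s (G₂ i p)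
    glue-↑ʳ i p = cong (λ column → column p) (lookup-++ʳ ((shiftˡ r ∘_) ∘ G₁) ((shiftʳ s ∘_) ∘ G₂) i)

    coherent-↑ˡ : ∀ i p → coherent f (i ↑ˡ r , p) (f (i ↑ˡ r , p)) ≡ coherent (cells G₁) (i , p) (G₁ i p)
    coherent-↑ˡ i p = trans (cong (coherent f (i ↑ˡ r , p)) (glue-↑ˡ i p)) (shifted (G₁ i p))
      where
      shifted : ∀ ℓ → coherent f (i ↑ˡ r , p) (shiftˡ r ℓ) ≡ coherent (cells G₁) (i , p) ℓ
      shifted (inj₁ _)              = refl
      shifted (inj₂ ((j , p′) , c)) =
        cong₂ _∧_ (adjacent-↑ˡ r i j p p′)
                  (trans (cong (λ ℓ → labelIs q ℓ (i ↑ˡ r , p) c) (glue-↑ˡ j p′)) (labelIs-shiftˡ r i p (G₁ j p′) c))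

    coherent-↑ʳ : ∀ i p → coherent f (s ↑ʳ i , p) (f (s ↑ʳ i , p)) ≡ coherent (cells G₂) (i , p) (G₂ i p)
    coherent-↑ʳ i p = trans (cong (coherent f (s ↑ʳ i , p)) (glue-↑ʳ i p)) (shifted (G₂ i p))
      where
      shifted : ∀ ℓ → coherent f (s ↑ʳ i , p) (shiftʳ s ℓ) ≡ coherent (cells G₂) (i , p) ℓ
      shifted (inj₁ _)              = refl
      shifted (inj₂ ((j , p′) , c)) =
        cong₂ _∧_ (adjacent-↑ʳ s i j p p′)
                  (trans (cong (λ ℓ → labelIs q ℓ (s ↑ʳ i , p) c) (glue-↑ʳ j p′)) (labelIs-shiftʳ s i p (G₂ j p′) c))

    tiling-glue : tiling (glue G₁ G₂) ≡ tiling G₁ ∧ tiling G₂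
    tiling-glue = bool-ext
      (λ t → cong₂ _∧_
        (coherent⇒isTiling (cells G₁) (λ (i , p) →
           trans (sym (coherent-↑ˡ i p)) (isTiling⇒coherent f t (i ↑ˡ r , p))))
        (coherent⇒isTiling (cells G₂) (λ (i , p) →
           trans (sym (coherent-↑ʳ i p)) (isTiling⇒coherent f t (s ↑ʳ i , p)))))
      (λ t → coherent⇒isTiling f (λ (j , p) → ↑-elim s (λ j → coherent f (j , p) (f (j , p)) ≡ true)
        (λ i → trans (coherent-↑ˡ i p) (isTiling⇒coherent (cells G₁) (∧-conicalˡ _ _ t) (i , p)))
        (λ i → trans (coherent-↑ʳ i p) (isTiling⇒coherent (cells G₂) (∧-conicalʳ _ _ t) (i , p)))
        j))

    crossesAt-glue : ∀ i → crossesAt f (s + i) ≡ crossesAt (cells G₂) i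
    crossesAt-glue i = bool-ext to from
      where
      crossing-↑ˡ : ∀ k p → crosses q (s + i) (k ↑ˡ r , p) (f (k ↑ˡ r , p)) ≡ false
      crossing-↑ˡ k p = trans (cong (crosses q (s + i) (k ↑ˡ r , p)) (glue-↑ˡ k p)) (crosses-shiftˡ s i k p (G₁ k p))
      crossing-↑ʳ : ∀ k p → crosses q (s + i) (s ↑ʳ k , p) (f (s ↑ʳ k , p)) ≡ crosses q i (k , p) (G₂ k p)
      crossing-↑ʳ k p = trans (cong (crosses q (s + i) (s ↑ʳ k , p)) (glue-↑ʳ k p)) (crosses-shiftʳ s i k p (G₂ k p))
      to : crossesAt f (s + i) ≡ true → crossesAt (cells G₂) i ≡ true
      to crossing with anyB-elim (allCells q (s + r)) crossing
      ... | (j , p) , e =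
        ↑-elim s (λ j → crosses q (s + i) (j , p) (f (j , p)) ≡ true → crossesAt (cells G₂) i ≡ true)
          (λ k e → contradiction (trans (sym e) (crossing-↑ˡ k p)) λ ())
          (λ k e → anyB-intro (allCells q r) (∈-allCells (k , p)) (trans (sym (crossing-↑ʳ k p)) e))
          j e
      from : crossesAt (cells G₂) i ≡ true → crossesAt f (s + i) ≡ true
      from crossing with anyB-elim (allCells q r) crossing
      ... | (k , p) , e = anyB-intro (allCells q (s + r)) (∈-allCells (s ↑ʳ k , p)) (trans (crossing-↑ʳ k p) e)

    breakableAt-glue : ∀ i → breakableAt q (s + r) a b f (s + i) ≡ breakableAt q r a b (cells G₂) i
    breakableAt-glue i = cong not (crossesAt-glue i)

  grids : ∀ n → List (Grid n)
  grids n = allFuns n (allFuns (q ∸ 2) (allLabels q n a b))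

  R-grids : ∀ n → R q a b n ≡ ∑[ F ∈ grids n ] iverson (tiling F)
  R-grids n = trans (length-filterᵇ _ (allAssignments q n a b)) (sumOver-map cells (grids n) _)

  Rt-grids : ∀ n → Rt q a b n ≡
    ∑[ F ∈ grids n ] iverson (tiling F ∧ unbreakable F)
  Rt-grids n = trans (length-filterᵇ _ (allAssignments q n a b)) (sumOver-map cells (grids n) _)

  _≋_ : ∀ {n} → Rel (Grid n) 0ℓ
  _≋_ = Pointwise (Pointwise _≡_)

  lastBreakAt : ∀ {n} → ℕ → Grid n → ℕ
  lastBreakAt {n} s F = iverson (tiling F ∧ lastBelow (breakableAt q n a b (cells F)) n s)

  lastBreakAt-cong : ∀ {n} s → lastBreakAt {n} s Preserves _≋_ ⟶ _≡_
  lastBreakAt-cong {n} s {F} {G} F≋G =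
    cong iverson (cong₂ _∧_ (isTiling-cong F≗G) (cong₂ _∧_ (breakableAt-cong F≗G s) later-cong))
    where
    F≗G : ∀ x → cells F x ≡ cells G x
    F≗G (j , p) = F≋G j p
    later-cong = allB-cong (λ i → cong not (breakableAt-cong F≗G (s + i))) (positions (n ∸ s))

  lastBreakAt-crossing : ∀ {n} s (F : Grid n) x → crosses q s x (cells F x) ≡ true → lastBreakAt s F ≡ 0
  lastBreakAt-crossing {n} s F x crossing = begin
    iverson (tiling F ∧ (breakableAt q n a b (cells F) s ∧ later))
      ≡⟨ cong (λ z → iverson (tiling F ∧ (not z ∧ later))) (anyB-intro (allCells q n) (∈-allCells x) crossing) ⟩
    iverson (tiling F ∧ false)
      ≡⟨ cong iverson (∧-zeroʳ _) ⟩
    0 ∎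
    where
    later = allB (λ i → not (breakableAt q n a b (cells F) (s + i))) (positions (n ∸ s))

  lastBreakAt-glue : ∀ {s r} (G₁ : Grid s) (G₂ : Grid r) → lastBreakAt s (glue G₁ G₂) ≡
    iverson (tiling G₁) * iverson (tiling G₂ ∧ unbreakable G₂)
  lastBreakAt-glue {s} {r} G₁ G₂ = begin
    iverson (tiling (glue G₁ G₂) ∧ (breaks s ∧ allB (λ i → not (breaks (s + i))) (positions (s + r ∸ s))))
      ≡⟨ cong iverson (cong₂ _∧_ tiling-glue (cong₂ _∧_ breaks-at-s unbreakable-after-s)) ⟩
    iverson ((tiling G₁ ∧ tiling G₂) ∧ unbreakable G₂)
      ≡⟨ cong iverson (∧-assoc (tiling G₁) (tiling G₂) _) ⟩
    iverson (tiling G₁ ∧ (tiling G₂ ∧ unbreakable G₂))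
      ≡⟨ iverson-∧ (tiling G₁) _ ⟩
    iverson (tiling G₁) * iverson (tiling G₂ ∧ unbreakable G₂)
      ∎
    where
    open Gluing G₁ G₂
    breaks = breakableAt q (s + r) a b (cells (glue G₁ G₂))
    breaks-at-s : breaks s ≡ true
    breaks-at-s =
      trans (cong breaks (sym (+-identityʳ s))) (trans (breakableAt-glue 0) (breakableAt-zero (cells G₂)))
    unbreakable-after-s : allB (λ i → not (breaks (s + i))) (positions (s + r ∸ s)) ≡ unbreakable G₂
    unbreakable-after-s = trans (cong (λ k → allB (λ i → not (breaks (s + i))) (positions k)) (m+n∸m≡n s r))
                                (allB-cong (λ i → cong not (breakableAt-glue i)) (positions r))

  module _ {s r} (F₁ : Vector (Column (s + r)) s) (F₂ : Vector (Column (s + r)) r) where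

    lastBreakAt-partnerRight : Any (Any (PartnerIn (s ≤_))) F₁ → lastBreakAt s (F₁ ++ᵛ F₂) ≡ 0
    lastBreakAt-partnerRight (i , p , partner) = lastBreakAt-crossing s (F₁ ++ᵛ F₂) (i ↑ˡ r , p)
      (trans (cong (λ column → crosses q s (i ↑ˡ r , p) (column p)) (lookup-++ˡ F₁ F₂ i))
             (crosses-partnerRight s r i p (F₁ i p) partner))

    lastBreakAt-partnerLeft : Any (Any (PartnerIn (_< s))) F₂ → lastBreakAt s (F₁ ++ᵛ F₂) ≡ 0
    lastBreakAt-partnerLeft (i , p , partner) = lastBreakAt-crossing s (F₁ ++ᵛ F₂) (s ↑ʳ i , p)
      (trans (cong (λ column → crosses q s (s ↑ʳ i , p) (column p)) (lookup-++ʳ F₁ F₂ i))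
             (crosses-partnerLeft s r i p (F₂ i p) partner))

  -- A grid of s + r columns with a domino label pointing across position s contributes nothing,
  -- and the remaining ones are exactly the gluings of a grid of s and a grid of r columns.
  lastBreak-count : ∀ s r → (∑[ F ∈ grids (s + r) ] lastBreakAt s F) ≡ R q a b s * Rt q a b r
  lastBreak-count s r = begin
    (∑[ F ∈ grids (s + r) ] lastBreakAt s F)
      ≡⟨ sumOver-allFuns-+ (Pointwise _≡_) (λ _ → refl) s r _ (lastBreakAt s) (lastBreakAt-cong s) ⟩
    (∑[ F₁ ∈ allFuns s columns ] ∑[ F₂ ∈ allFuns r columns ] lastBreakAt s (F₁ ++ᵛ F₂))
      ≡⟨ left-transfer _
           (λ F₁≋G₁ → sumOver-cong (allFuns r columns) (λ F₂ →
              lastBreakAt-cong s (++ᵛ-cong (Pointwise _≡_) (λ _ → refl) s F₁≋G₁ (λ _ _ → refl))))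
           (λ F₁ partner → sumOver-zero (allFuns r columns) (λ F₂ → lastBreakAt-partnerRight F₁ F₂ partner)) ⟩
    (∑[ G₁ ∈ grids s ] ∑[ F₂ ∈ allFuns r columns ] lastBreakAt s (((shiftˡ r ∘_) ∘ G₁) ++ᵛ F₂))
      ≡⟨ sumOver-cong (grids s) (λ G₁ → right-transfer _
           (λ F₂≋G₂ → lastBreakAt-cong s (++ᵛ-cong (Pointwise _≡_) (λ _ → refl) s (λ _ _ → refl) F₂≋G₂))
           (λ F₂ → lastBreakAt-partnerLeft ((shiftˡ r ∘_) ∘ G₁) F₂)) ⟩
    (∑[ G₁ ∈ grids s ] ∑[ G₂ ∈ grids r ] lastBreakAt s (glue G₁ G₂))
      ≡⟨ sumOver-cong (grids s) (λ G₁ → sumOver-cong (grids r) (lastBreakAt-glue G₁)) ⟩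
    (∑[ G₁ ∈ grids s ] ∑[ G₂ ∈ grids r ] iverson (tiling G₁) * iverson (tiling G₂ ∧ unbreakable G₂))
      ≡⟨ sumOver-* (grids s) (grids r) _ _ ⟩
    (∑[ G₁ ∈ grids s ] iverson (tiling G₁)) * (∑[ G₂ ∈ grids r ] iverson (tiling G₂ ∧ unbreakable G₂))
      ≡⟨ sym (cong₂ _*_ (R-grids s) (Rt-grids r)) ⟩
    R q a b s * Rt q a b r
      ∎
    where
    columns = allFuns (q ∸ 2) (allLabels q (s + r) a b)
    left-transfer = SumTransfer-allFuns (λ _ → refl) (SumTransfer-allFuns refl (shiftˡ-transfer s r) (q ∸ 2)) s
    right-transfer = SumTransfer-allFuns (λ _ → refl) (SumTransfer-allFuns refl (shiftʳ-transfer s r) (q ∸ 2)) r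

  renewal : ∀ m → 1 ≤ m → R q a b m ≡ ∑[ s < m ] R q a b s * Rt q a b (m ∸ s)
  renewal m 1≤m = begin
    R q a b m
      ≡⟨ R-grids m ⟩
    (∑[ F ∈ grids m ] iverson (tiling F))
      ≡⟨ sumOver-cong (grids m) split-by-last-break ⟩
    (∑[ F ∈ grids m ] ∑[ s < m ] lastBreakAt s F)
      ≡⟨ sumOver-sumBelow (grids m) m (λ F s → lastBreakAt s F) ⟩
    (∑[ s < m ] ∑[ F ∈ grids m ] lastBreakAt s F)
      ≡⟨ sumBelow-cong m (λ s s<m →
           trans (cong (λ n → ∑[ F ∈ grids n ] lastBreakAt s F) (sym (m+[n∸m]≡n (<⇒≤ s<m))))
                 (lastBreak-count s (m ∸ s))) ⟩
    (∑[ s < m ] R q a b s * Rt q a b (m ∸ s))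
      ∎
    where
    split-by-last-break : ∀ F → iverson (tiling F) ≡ ∑[ s < m ] lastBreakAt s F
    split-by-last-break F = begin
      iverson T
        ≡⟨ sym (*-identityʳ _) ⟩
      iverson T * 1
        ≡⟨ cong (iverson T *_) (sym (sumBelow-lastBelow breaks (breakableAt-zero (cells F)) m 1≤m)) ⟩
      iverson T * (∑[ s < m ] iverson (lastBelow breaks m s))
        ≡⟨ sym (sumBelow-*ˡ m _ (iverson T)) ⟩
      (∑[ s < m ] iverson T * iverson (lastBelow breaks m s))
        ≡⟨ sumBelow-cong m (λ s _ → sym (iverson-∧ T (lastBelow breaks m s))) ⟩
      (∑[ s < m ] lastBreakAt s F)
        ∎
      where
      T = tiling F
      breaks = breakableAt q m a b (cells F)

mainTheorem9 : (q a b : ℕ) → 4 ≤ q → 1 ≤ a → 1 ≤ b →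
    (n k : ℕ) → 1 ≤ n → 2 ≤ k →
    R q a b (k * n) ≡
      R q a b n * R q a b ((k ∸ 1) * n)
      + sum1to n (λ i → sum1to ((k ∸ 1) * n) (λ j →
          R q a b (n ∸ i) * R q a b ((k ∸ 1) * n ∸ j) * Rt q a b (i + j)))
mainTheorem9 q a b _ _ _ n (suc k) _ _ = begin
  R q a b (n + k * n)
    ≡⟨ R-+ n (k * n) ⟩
  R q a b n * R q a b (k * n) + crossing n (k * n)
    ≡⟨ cong (R q a b n * R q a b (k * n) +_) (sym (crossing-sum1to n (k * n))) ⟩
  R q a b n * R q a b (k * n)
    + sum1to n (λ i → sum1to (k * n) (λ j → R q a b (n ∸ i) * R q a b (k * n ∸ j) * Rt q a b (i + j)))
    ∎
  where
  open Renewal (R q a b) (Rt q a b) refl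
               (λ m 1≤m → trans (Board.renewal q a b m 1≤m) (sumBelow-⋆ (R q a b) (Rt q a b) m))
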